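{- Let $G$ be a finite graph, let $\mathcal{F}$ be an arbitrary family of graphs, and let $A,B\subseteq V(G)$ with $B\subseteq A$. Then $\iota_{\rm g}(G|A,\mathcal{F})\le \iota_{\rm g}(G|B,\mathcal{F})$ and $\iota_{\rm g}'(G|A,\mathcal{F})\le \iota_{\rm g}'(G|B,\mathcal{F})$.
   Context: All graphs are finite and simple. For $S\subseteq V(G)$, $N[S]=N_G[S]$ is the closed neighborhood of $S$ (the union of the closed neighborhoods $N[v]=\{v\}\cup\{u: uv\in E(G)\}$, $v\in S$). A graph $H$ is $\mathcal{F}$-forbidden if no member of $\mathcal{F}$ is a subgraph of $H$. The $\mathcal{F}$-isolation game on a partially marked graph $G|A$ ($A\subseteq V(G)$): two players, Dominator and Staller, alternately choose vertices. A set $M$ of marked vertices is maintained; initially $M$ consists of $A$ together with all vertices of $\mathcal{F}$-forbidden components of $G-A$ (the paper defines $G|A$ only for $A$ such that $G-A$ has no $\mathcal{F}$-forbidden component, in which case $M=A$; for $A=\emptyset$ this gives the ordinary game on $G$). A vertex $x$ may be chosen (is playable) only if $N[x]\not\subseteq M$. When $x$ is chosen, $M$ is replaced by $M\cup N[x]\cup U$, where $U$ is the set of vertices lying in $\mathcal{F}$-forbidden components of $G-(M\cup N[x])$. The game ends when every vertex is marked. Dominator wants to minimize the total number of chosen vertices, Staller wants to maximize it. $\iota_{\rm g}(G|A,\mathcal{F})$ (resp. $\iota_{\rm g}'(G|A,\mathcal{F})$) is the number of chosen vertices under optimal play of both players when Dominator (resp. Staller) makes the first move. -}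

module Defs where

open import Data.Nat using (ℕ; zero; suc)
open import Data.Bool using (Bool; true; false; _∨_)
open import Data.Fin using (Fin; _≟_)
open import Data.Fin.Subset using (Subset; _∈_; _∉_; _⊆_; _∪_)
open import Data.Vec using (tabulate)
open import Data.Product using (Σ; _×_; ∃)
open import Data.Sum using (_⊎_)
open import Function using (_⇔_)
open import Function.Definitions using (Injective)
open import Relation.Nullary using (¬_; does)
open import Relation.Binary.PropositionalEquality using (_≡_)

record Graph (n : ℕ) : Set where
  field
    adj    : Fin n → Fin n → Bool
    sym    : ∀ i j → adj i j ≡ adj j i
    irrefl : ∀ i → adj i i ≡ false
open Graph public

Family : Set₁
Family = (m : ℕ) → Graph m → Set

data Player : Set where
  Dom Sta : Player

module _ {n : ℕ} (G : Graph n) where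

  nbhd : Fin n → Subset n
  nbhd x = tabulate (λ v → does (v ≟ x) ∨ adj G x v)

  -- Reach S v u : u lies in the component of v in G - S (v, u ∉ S)
  data Reach (S : Subset n) : Fin n → Fin n → Set where
    here : ∀ {v} → v ∉ S → Reach S v v
    step : ∀ {v u w} → Reach S v u → adj G u w ≡ true → w ∉ S → Reach S v w

  -- the component of v in G - S contains a copy of F as a (not necessarily induced) subgraph
  CompContains : (S : Subset n) → Fin n → {m : ℕ} → Graph m → Set
  CompContains S v {m} F =
    Σ (Fin m → Fin n) λ f →
      Injective _≡_ _≡_ f
      × (∀ i → Reach S v (f i))
      × (∀ i j → adj F i j ≡ true → adj G (f i) (f j) ≡ true)

  InForbiddenComp : Family → Subset n → Fin n → Set
  InForbiddenComp ℱ S v =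
    v ∉ S × (∀ m (F : Graph m) → ℱ m F → ¬ CompContains S v F)

  -- initial marked set of G|A : A together with all vertices of ℱ-forbidden components of G - A
  Start : Family → Subset n → Subset n → Set
  Start ℱ A M = ∀ v → (v ∈ M ⇔ (v ∈ A ⊎ InForbiddenComp ℱ A v))

  Playable : Subset n → Fin n → Set
  Playable M x = ¬ (nbhd x ⊆ M)

  AllMarked : Subset n → Set
  AllMarked M = ∀ v → v ∈ M

  Next : Family → Subset n → Fin n → Subset n → Set
  Next ℱ M x M' =
    ∀ v → (v ∈ M' ⇔ (v ∈ (M ∪ nbhd x) ⊎ InForbiddenComp ℱ (M ∪ nbhd x) v))

  -- DomForce ℱ p M k : with marked set M and player p to move,
  -- Dominator can ensure that at most k further vertices are chosen.
  data DomForce (ℱ : Family) : Player → Subset n → ℕ → Set where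
    done  : ∀ {p M k} → AllMarked M → DomForce ℱ p M k
    dmove : ∀ {M k} x → Playable M x →
            (∀ M' → Next ℱ M x M' → DomForce ℱ Sta M' k) →
            DomForce ℱ Dom M (suc k)
    smove : ∀ {M k} →
            (∀ x → Playable M x → ∀ M' → Next ℱ M x M' → DomForce ℱ Dom M' k) →
            DomForce ℱ Sta M (suc k)

  -- StaForce ℱ p M k : with marked set M and player p to move,
  -- Staller can ensure that at least k further vertices are chosen.
  data StaForce (ℱ : Family) : Player → Subset n → ℕ → Set where
    zero  : ∀ {p M} → StaForce ℱ p M zero
    smove : ∀ {M k} x → Playable M x →
            (∀ M' → Next ℱ M x M' → StaForce ℱ Dom M' k) →
            StaForce ℱ Sta M (suc k)
    dmove : ∀ {M k} → ∃ (λ v → v ∉ M) →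
            (∀ x → Playable M x → ∀ M' → Next ℱ M x M' → StaForce ℱ Sta M' k) →
            StaForce ℱ Dom M (suc k)

  -- GameValue ℱ A p k : the ℱ-isolation game on G|A with player p moving first
  -- has value k under optimal play (Dominator can force ≤ k, Staller can force ≥ k).
  -- ι_g(G|A,ℱ) = k  is  GameValue ℱ A Dom k ;  ι_g'(G|A,ℱ) = k  is  GameValue ℱ A Sta k.
  GameValue : Family → Subset n → Player → ℕ → Set
  GameValue ℱ A p k =
    Σ (Subset n) λ M → Start ℱ A M × DomForce ℱ p M k × StaForce ℱ p M k

-- Play a Dominator strategy in the less-marked position against a Staller strategy
-- in the more-marked one, keeping the first marked set inside the second. A Staller
-- move legal in the more-marked game is legal in the other; a Dominator move x that
-- is no longer legal there (N[x] already marked) is replaced by any unmarked vertex.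
-- Marking is monotone, since growing S only shrinks the components of G − S and so
-- keeps forbidden ones forbidden; hence the inclusion persists, and the game on the
-- larger marked set ends no later. Being ℱ-forbidden is undecidable, so the next
-- marked set exists only up to double negation; the comparison is therefore proved
-- in the negative form ¬ (j < k), which suffices because _<_ on ℕ is decidable.
module Submission where

open import Defs
open import Data.Nat using (ℕ; _≤_; _<_; s≤s)
open import Data.Nat.Properties using (≮⇒≥)
open import Data.Fin using (Fin; zero; suc; _≟_)
open import Data.Fin.Subset using (Subset; _⊆_; _∈_; _∉_; _∪_; inside; outside)
open import Data.Fin.Subset.Properties
  using (_∈?_; _⊆?_; ⊆-trans; p⊆p∪q; q⊆p∪q; x∈p∪q⁻; drop-there)
open import Data.Vec using ([]; _∷_; here; there)
open import Data.Vec.Properties using (lookup∘tabulate; lookup⇒[]=)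
open import Data.Product using (_×_; _,_; ∃; ∃₂)
open import Data.Sum using (_⊎_; inj₁; inj₂; [_,_])
open import Data.Empty using (⊥-elim)
open import Data.Bool using (_∨_)
open import Function using (_∘_; const; _⇔_; mk⇔; Equivalence)
open import Relation.Nullary using (¬_; Dec; yes; no; ¬¬-excluded-middle)
open import Relation.Nullary.Decidable using (dec-true)
open import Relation.Binary.PropositionalEquality using (refl; trans; cong)

open Equivalence using (to; from)

¬¬-subset : ∀ {n} (P : Fin n → Set) → ¬ ¬ ∃ λ (M : Subset n) → ∀ v → v ∈ M ⇔ P v
¬¬-subset {ℕ.zero} P k = k ([] , λ ())
¬¬-subset {ℕ.suc n} P k =
  ¬¬-excluded-middle λ P0? → ¬¬-subset (P ∘ suc) λ (M , M≈P) → k (extend P0? M M≈P)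
  where
  extend : Dec (P zero) → ∀ M → (∀ v → v ∈ M ⇔ P (suc v)) →
           ∃ λ M′ → ∀ v → v ∈ M′ ⇔ P v
  extend (yes p0) M M≈P = inside ∷ M , λ
    { zero    → mk⇔ (const p0) (const here)
    ; (suc v) → mk⇔ (to (M≈P v) ∘ drop-there) (there ∘ from (M≈P v)) }
  extend (no ¬p0) M M≈P = outside ∷ M , λ
    { zero    → mk⇔ (λ ()) (⊥-elim ∘ ¬p0)
    ; (suc v) → mk⇔ (to (M≈P v) ∘ drop-there) (there ∘ from (M≈P v)) }

module _ {n : ℕ} where

  ∪-lub : {p q r : Subset n} → p ⊆ r → q ⊆ r → p ∪ q ⊆ r
  ∪-lub {p} {q} p⊆r q⊆r = [ p⊆r , q⊆r ] ∘ x∈p∪q⁻ p q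

  ∪-monoˡ-⊆ : {p q r : Subset n} → p ⊆ q → p ∪ r ⊆ q ∪ r
  ∪-monoˡ-⊆ {q = q} {r} p⊆q = ∪-lub (⊆-trans p⊆q (p⊆p∪q r)) (q⊆p∪q q r)

module _ {n : ℕ} (G : Graph n) where

  x∈nbhd[x] : ∀ x → x ∈ nbhd G x
  x∈nbhd[x] x = lookup⇒[]= x (nbhd G x)
    (trans (lookup∘tabulate _ x) (cong (_∨ adj G x x) (dec-true (x ≟ x) refl)))

  Playable-antitone : ∀ {M M′ x} → M ⊆ M′ → Playable G M′ x → Playable G M x
  Playable-antitone M⊆M′ N⊈M′ N⊆M = N⊈M′ (⊆-trans N⊆M M⊆M′)

  unmarked-playable : ∀ {M v} → v ∉ M → Playable G M v
  unmarked-playable v∉M N⊆M = v∉M (N⊆M (x∈nbhd[x] _))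

  imitation-move : ∀ {M M′} → M ⊆ M′ → ∃ (_∉ M′) → ∀ x →
                   ∃ λ y → Playable G M′ y × M ∪ nbhd G x ⊆ M′ ∪ nbhd G y
  imitation-move {M′ = M′} M⊆M′ (v , v∉M′) x with nbhd G x ⊆? M′
  ... | yes N⊆M′ = v , unmarked-playable v∉M′ , ⊆-trans (∪-lub M⊆M′ N⊆M′) (p⊆p∪q _)
  ... | no N⊈M′  = x , N⊈M′ , ∪-monoˡ-⊆ M⊆M′

  Reach-antitone : ∀ {S S′ v u} → S ⊆ S′ → Reach G S′ v u → Reach G S v u
  Reach-antitone S⊆S′ (here v∉S′)       = here (v∉S′ ∘ S⊆S′)
  Reach-antitone S⊆S′ (step r uw w∉S′) = step (Reach-antitone S⊆S′ r) uw (w∉S′ ∘ S⊆S′)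

  CompContains-antitone : ∀ {S S′ v m} (F : Graph m) → S ⊆ S′ →
                          CompContains G S′ v F → CompContains G S v F
  CompContains-antitone _ S⊆S′ (f , f-inj , reach , f-hom) =
    f , f-inj , Reach-antitone S⊆S′ ∘ reach , f-hom

  module _ (ℱ : Family) where

    Marked : Subset n → Fin n → Set
    Marked S v = v ∈ S ⊎ InForbiddenComp G ℱ S v

    IsMarking : Subset n → Subset n → Set
    IsMarking S M = ∀ v → v ∈ M ⇔ Marked S v

    Marked-mono : ∀ {S S′ v} → S ⊆ S′ → Marked S v → Marked S′ v
    Marked-mono S⊆S′ (inj₁ v∈S) = inj₁ (S⊆S′ v∈S)
    Marked-mono {S′ = S′} {v} S⊆S′ (inj₂ (_ , forbidden)) with v ∈? S′
    ... | yes v∈S′ = inj₁ v∈S′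
    ... | no v∉S′  = inj₂ (v∉S′ , λ m F F∈ℱ →
      forbidden m F F∈ℱ ∘ CompContains-antitone F S⊆S′)

    IsMarking-mono : ∀ {S S′ M M′} → S ⊆ S′ → IsMarking S M → IsMarking S′ M′ → M ⊆ M′
    IsMarking-mono S⊆S′ M≈S M′≈S′ v∈M = from (M′≈S′ _) (Marked-mono S⊆S′ (to (M≈S _) v∈M))

    ¬¬-markings-⊆ : ∀ {S S′} → S ⊆ S′ →
                    ¬ ¬ ∃₂ λ M M′ → IsMarking S M × IsMarking S′ M′ × M ⊆ M′
    ¬¬-markings-⊆ {S} {S′} S⊆S′ k =
      ¬¬-subset (Marked S) λ (M , M≈S) → ¬¬-subset (Marked S′) λ (M′ , M′≈S′) →
      k (M , M′ , M≈S , M′≈S′ , IsMarking-mono S⊆S′ M≈S M′≈S′)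

    DomForce-≮-StaForce : ∀ {p M M′ j k} → M ⊆ M′ →
                          DomForce G ℱ p M j → StaForce G ℱ p M′ k → ¬ (j < k)
    DomForce-≮-StaForce _ _ zero ()
    DomForce-≮-StaForce M⊆M′ (done all) (smove _ N⊈M′ _) _ =
      Playable-antitone M⊆M′ N⊈M′ (λ _ → all _)
    DomForce-≮-StaForce M⊆M′ (done all) (dmove (v , v∉M′) _) _ = v∉M′ (M⊆M′ (all v))
    DomForce-≮-StaForce M⊆M′ (dmove x _ dom) (dmove unmarked sta) (s≤s j<k)
      with imitation-move M⊆M′ unmarked x
    ... | y , y-playable , next⊆ = ¬¬-markings-⊆ next⊆ λ (_ , _ , N≈ , N′≈ , N⊆N′) →
      DomForce-≮-StaForce N⊆N′ (dom _ N≈) (sta y y-playable _ N′≈) j<k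
    DomForce-≮-StaForce M⊆M′ (smove dom) (smove x x-playable sta) (s≤s j<k) =
      ¬¬-markings-⊆ (∪-monoˡ-⊆ M⊆M′) λ (_ , _ , N≈ , N′≈ , N⊆N′) →
      DomForce-≮-StaForce N⊆N′
        (dom x (Playable-antitone M⊆M′ x-playable) _ N≈) (sta _ N′≈) j<k

lemma2p2 : ∀ {n} (G : Graph n) (ℱ : Family) (A B : Subset n) → B ⊆ A →
    (∀ k₁ k₂ → GameValue G ℱ A Dom k₁ → GameValue G ℱ B Dom k₂ → k₁ ≤ k₂)
    × (∀ k₁ k₂ → GameValue G ℱ A Sta k₁ → GameValue G ℱ B Sta k₂ → k₁ ≤ k₂)
lemma2p2 G ℱ A B B⊆A = value-mono , value-mono
  where
  value-mono : ∀ {p} k₁ k₂ → GameValue G ℱ A p k₁ → GameValue G ℱ B p k₂ → k₁ ≤ k₂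
  value-mono _ _ (_ , startA , _ , staA) (_ , startB , domB , _) =
    ≮⇒≥ (DomForce-≮-StaForce G ℱ (IsMarking-mono G ℱ B⊆A startB startA) domB staA)
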